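{- Let $G$ be an Eulerian graph on an even number $n$ of vertices, and let $A$ be its adjacency matrix regarded over $\mathbb{F}_2$. Let $\mathbb{F}$ be the splitting field over $\mathbb{F}_2$ of the characteristic polynomial of $A$, and let $A=PJP^{ -1}$ with $P\in M_{n\times n}(\mathbb{F})$ invertible and $J=\mathrm{diag}(J_1,\ldots,J_t)$ a Jordan normal form of $A$ over $\mathbb{F}$, where $J_i$ is the $\ell_i\times\ell_i$ Jordan block with eigenvalue $\lambda_i$ (so, writing the columns of $P$ as $\alpha_{11},\ldots,\alpha_{1\ell_1},\ldots,\alpha_{t1},\ldots,\alpha_{t\ell_t}$, we have $A\alpha_{i1}=\lambda_i\alpha_{i1}$ and $A\alpha_{i,k+1}=\lambda_i\alpha_{i,k+1}+\alpha_{ik}$ for $1\le k<\ell_i$), and where $\alpha_{11}=e$ is the all-one vector. Let $Q=P^{\rm T}P$, partitioned into blocks $Q_{ij}$ (of size $\ell_i\times\ell_j$) conformally with $J$, so that the $(j,k)$ entry of $Q_{ii}$ is $\alpha_{ij}^{\rm T}\alpha_{ik}$. If $\lambda_i=0$, then every entry of $Q_{ii}$ is $0$ except possibly the entry at position $(\ell_i,\ell_i)$.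
   Context: An Eulerian graph is a connected graph in which every vertex has even degree. Since all degrees are even, $Ae=0$ over $\mathbb{F}_2$, so $e$ can be chosen as the first column of $P$ in a Jordan block for eigenvalue $0$. -}

module Defs where

open import Level using (Level; _⊔_)
open import Algebra.Bundles using (CommutativeRing)
open import Data.Nat as ℕ using (ℕ)
open import Data.Nat.Divisibility using (_∣_)
open import Data.Fin as Fin using (Fin; toℕ)
open import Data.Nat.ListAction using (sum)
open import Data.Bool using (Bool; true; false; if_then_else_)
open import Data.Product using (Σ; ∃; _×_; _,_)
open import Data.List using (allFin; map)
open import Relation.Nullary using (¬_)
open import Relation.Binary.PropositionalEquality using (_≡_)

record Field (c ℓ : Level) : Set (Level.suc (c ⊔ ℓ)) where
  field
    commutativeRing : CommutativeRing c ℓ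
  open CommutativeRing commutativeRing public
  field
    0≉1     : ¬ (0# ≈ 1#)
    inverse : ∀ x → ¬ (x ≈ 0#) → Σ Carrier λ y → (x * y) ≈ 1#

HasChar2 : ∀ {c ℓ} → Field c ℓ → Set ℓ
HasChar2 F = (1# + 1#) ≈ 0#
  where open Field F

record Graph (n : ℕ) : Set where
  field
    adj       : Fin n → Fin n → Bool
    symmetric : ∀ i j → adj i j ≡ adj j i
    loopless  : ∀ i → adj i i ≡ false
open Graph public

data Reach {n : ℕ} (G : Graph n) : Fin n → Fin n → Set where
  here : ∀ {i} → Reach G i i
  step : ∀ {i j k} → adj G i j ≡ true → Reach G j k → Reach G i k

Connected : ∀ {n} → Graph n → Set
Connected {n} G = ∀ (i j : Fin n) → Reach G i j

degree : ∀ {n} → Graph n → Fin n → ℕ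
degree {n} G i = sum (map (λ j → if adj G i j then 1 else 0) (allFin n))

Eulerian : ∀ {n} → Graph n → Set
Eulerian {n} G = Connected G × (∀ (i : Fin n) → 2 ∣ degree G i)

sumℕ : ∀ m → (Fin m → ℕ) → ℕ
sumℕ ℕ.zero    f = 0
sumℕ (ℕ.suc m) f = f Fin.zero ℕ.+ sumℕ m (λ i → f (Fin.suc i))

isSame : ∀ {t} {size : Fin t → ℕ} (i : Fin t) → Fin (size i) →
         (i' : Fin t) → Fin (size i') → Bool
isSame i k i' k' = (toℕ i ℕ.≡ᵇ toℕ i') Data.Bool.∧ (toℕ k ℕ.≡ᵇ toℕ k')


module _ {c ℓ} (F : Field c ℓ) where
  open Field F

  sumF : ∀ n → (Fin n → Carrier) → Carrier
  sumF ℕ.zero    f = 0#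
  sumF (ℕ.suc n) f = f Fin.zero + sumF n (λ i → f (Fin.suc i))

  Vector : ℕ → Set c
  Vector n = Fin n → Carrier

  _≈ᵛ_ : ∀ {n} → Vector n → Vector n → Set ℓ
  u ≈ᵛ v = ∀ i → u i ≈ v i

  dot : ∀ {n} → Vector n → Vector n → Carrier
  dot {n} u v = sumF n (λ i → u i * v i)

  adjMatrix : ∀ {n} → Graph n → Fin n → Fin n → Carrier
  adjMatrix G i j = if adj G i j then 1# else 0#

  _·_ : ∀ {n} → (Fin n → Fin n → Carrier) → Vector n → Vector n
  _·_ {n} M v i = sumF n (λ j → M i j * v j)

  scale : ∀ {n} → Carrier → Vector n → Vector n
  scale a v i = a * v i

  addV : ∀ {n} → Vector n → Vector n → Vector n
  addV u v i = u i + v i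

  ones : ∀ {n} → Vector n
  ones _ = 1#

  -- The columns of P are indexed block-wise: col i k = α_{i,k+1}
  -- (k : Fin ℓᵢ, 0-based).  Invertibility of P is expressed by a
  -- two-sided inverse R (rows indexed block-wise, like the columns of P).

  record JordanDecomposition (n : ℕ) (A : Fin n → Fin n → Carrier) : Set (c ⊔ ℓ) where
    field
      t        : ℕ
      size     : Fin t → ℕ
      size≥1   : ∀ i → 1 ℕ.≤ size i
      size-sum : sumℕ t size ≡ n
      eigen    : Fin t → Carrier
      col      : (i : Fin t) → Fin (size i) → Vector n
      inv      : (i : Fin t) → Fin (size i) → Vector n
      invˡ     : ∀ i k i' k' →
                 dot (inv i k) (col i' k')
                   ≈ (if isSame {size = size} i k i' k' then 1# else 0#)
      invʳ     : ∀ (r s : Fin n) →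
                 sumF t (λ i → sumF (size i) (λ k → col i k r * inv i k s))
                   ≈ (if toℕ r ℕ.≡ᵇ toℕ s then 1# else 0#)
      chain-start : ∀ i (k : Fin (size i)) → toℕ k ≡ 0 →
                    (A · col i k) ≈ᵛ scale (eigen i) (col i k)
      chain-step  : ∀ i (k k' : Fin (size i)) → toℕ k' ≡ ℕ.suc (toℕ k) →
                    (A · col i k') ≈ᵛ addV (scale (eigen i) (col i k')) (col i k)

{-# OPTIONS --safe #-}
-- Over a field of characteristic 2 the adjacency matrix A is symmetric with
-- zero diagonal, so xᵀAx = 0 for every x; and xᵀx = (eᵀx)², where eᵀA = 0
-- because every degree is even, so (Ax)ᵀ(Ax) = 0 as well.  In a Jordan chain
-- for the eigenvalue 0 we have α_k = Aα_{k+1}, and self-adjointness of A gives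
-- α_jᵀα_{k+1} = α_{j+1}ᵀα_k.  Moving the two indices towards each other thus
-- reduces every entry of Q_ii to α_jᵀα_j = (Aα_{j+1})ᵀ(Aα_{j+1}) = 0 or to
-- α_jᵀα_{j+1} = (Aα_{j+1})ᵀα_{j+1} = 0; only the corner (ℓ_i, ℓ_i) has no
-- successor α_{j+1} to move to.
module Submission where

open import Defs
open import Algebra.Bundles using (Monoid)
open import Data.Bool using (true; false; if_then_else_)
open import Data.Fin as Fin using (Fin; toℕ; fromℕ<)
open import Data.Fin.Properties using (toℕ<n; toℕ-fromℕ<; fromℕ<-toℕ)
open import Data.List using (tabulate)
open import Data.List.Properties using (map-tabulate)
open import Data.Nat as ℕ using (ℕ; suc; _∸_; _≤_; _<_; _<?_; s≤s)
open import Data.Nat.Divisibility using (_∣_; divides)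
open import Data.Nat.Properties
  using (≤-trans; ≤-total; ≤-antisym; <⇒≤; m≤n+m; +-suc; m∸n+n≡m; m≤n⇒m<n∨m≡n)
import Data.Nat.ListAction as ℕ
import Data.Nat.Properties as ℕ
open import Data.Product using (_×_; _,_; swap)
open import Data.Sum using (inj₁; inj₂)
open import Function using (_∘_; id)
open import Relation.Nullary using (¬_; yes; no; contradiction)
open import Relation.Binary.PropositionalEquality as ≡ using (_≡_)
import Relation.Binary.Reasoning.Setoid as SetoidReasoning

below-corner⇒suc< : ∀ {j k L} → j ≤ k → k < L →
  ¬ (suc j ≡ L × suc k ≡ L) → suc j < L
below-corner⇒suc< {j} {k} {L} j≤k k<L not-corner with m≤n⇒m<n∨m≡n (≤-trans (s≤s j≤k) k<L)
... | inj₁ suc-j<L = suc-j<L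
... | inj₂ suc-j≡L =
  contradiction (suc-j≡L , ≤-antisym k<L (≡.subst (_≤ suc k) suc-j≡L (s≤s j≤k))) not-corner

module _ {a ℓ} (M : Monoid a ℓ) where
  open Monoid M renaming (_∙_ to _+_; ε to 0#)
  open import Algebra.Properties.Monoid.Sum M using (sum)
  open import Algebra.Properties.Monoid.Mult M renaming (_×_ to _×ᵐ_) using (×-homo-+)

  ×ᵐ-sum-tabulate : ∀ {n} (h : Fin n → ℕ) x →
    ℕ.sum (tabulate h) ×ᵐ x ≈ sum (λ r → h r ×ᵐ x)
  ×ᵐ-sum-tabulate {ℕ.zero}  h x = refl
  ×ᵐ-sum-tabulate {suc n} h x =
    trans (×-homo-+ x (h Fin.zero) _) (∙-congˡ (×ᵐ-sum-tabulate (h ∘ Fin.suc) x))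

module _ {c ℓ} (F : Field c ℓ) where
  open Field F
  open import Algebra.Properties.Semiring.Sum semiring
    using (sum; sum-cong-≋; sum-replicate-zero; ∑-comm; ∑-distrib-+; *-distribˡ-sum; *-distribʳ-sum)
  open import Algebra.Properties.Monoid.Mult +-monoid using (×-assocˡ) renaming (_×_ to _×ᵐ_)
  open SetoidReasoning setoid

  SymmetricMatrix : ∀ {n} → (Fin n → Fin n → Carrier) → Set ℓ
  SymmetricMatrix M = ∀ r s → M r s ≈ M s r

  sumF≡sum : ∀ n (f : Fin n → Carrier) → sumF F n f ≡ sum f
  sumF≡sum ℕ.zero  f = ≡.refl
  sumF≡sum (suc n) f = ≡.cong (f Fin.zero +_) (sumF≡sum n (f ∘ Fin.suc))

  dot-comm : ∀ {n} (u v : Vector F n) → dot F u v ≈ dot F v u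
  dot-comm {n} u v = begin
    dot F u v                 ≡⟨ sumF≡sum n _ ⟩
    sum (λ r → u r * v r)     ≈⟨ sum-cong-≋ (λ r → *-comm (u r) (v r)) ⟩
    sum (λ r → v r * u r)     ≡⟨ sumF≡sum n _ ⟨
    dot F v u                 ∎

  dot-cong : ∀ {n} {u u′ v v′ : Vector F n} →
    _≈ᵛ_ F u u′ → _≈ᵛ_ F v v′ → dot F u v ≈ dot F u′ v′
  dot-cong {n} {u} {u′} {v} {v′} u≈u′ v≈v′ = begin
    dot F u v                 ≡⟨ sumF≡sum n _ ⟩
    sum (λ r → u r * v r)     ≈⟨ sum-cong-≋ (λ r → *-cong (u≈u′ r) (v≈v′ r)) ⟩
    sum (λ r → u′ r * v′ r)   ≡⟨ sumF≡sum n _ ⟨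
    dot F u′ v′               ∎

  dot-·-expand : ∀ {n} (M : Fin n → Fin n → Carrier) (u v : Vector F n) →
    dot F u (_·_ F M v) ≈ sum (λ r → sum (λ s → u r * (M r s * v s)))
  dot-·-expand {n} M u v = begin
    dot F u (_·_ F M v)                          ≡⟨ sumF≡sum n _ ⟩
    sum (λ r → u r * sumF F n (λ s → M r s * v s))
      ≈⟨ sum-cong-≋ (λ r → *-congˡ (reflexive (sumF≡sum n (λ s → M r s * v s)))) ⟩
    sum (λ r → u r * sum (λ s → M r s * v s))
      ≈⟨ sum-cong-≋ (λ r → *-distribˡ-sum (u r) (λ s → M r s * v s)) ⟩
    sum (λ r → sum (λ s → u r * (M r s * v s)))  ∎

  *-sandwich-swap : ∀ {m m′} a b → m ≈ m′ → a * (m * b) ≈ b * (m′ * a)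
  *-sandwich-swap {m} {m′} a b m≈m′ = begin
    a * (m * b)   ≈⟨ *-comm a _ ⟩
    (m * b) * a   ≈⟨ *-congʳ (*-comm m b) ⟩
    (b * m) * a   ≈⟨ *-assoc b m a ⟩
    b * (m * a)   ≈⟨ *-congˡ (*-congʳ m≈m′) ⟩
    b * (m′ * a)  ∎

  ·-selfAdjoint : ∀ {n} {M : Fin n → Fin n → Carrier} → SymmetricMatrix M →
    ∀ u v → dot F u (_·_ F M v) ≈ dot F (_·_ F M u) v
  ·-selfAdjoint {n} {M} M-sym u v = begin
    dot F u (_·_ F M v)                          ≈⟨ dot-·-expand M u v ⟩
    sum (λ r → sum (λ s → u r * (M r s * v s)))  ≈⟨ ∑-comm (λ r s → u r * (M r s * v s)) ⟩
    sum (λ s → sum (λ r → u r * (M r s * v s)))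
      ≈⟨ sum-cong-≋ (λ s → sum-cong-≋ (λ r → *-sandwich-swap (u r) (v s) (M-sym r s))) ⟩
    sum (λ s → sum (λ r → v s * (M s r * u r)))  ≈⟨ dot-·-expand M v u ⟨
    dot F v (_·_ F M u)                          ≈⟨ dot-comm v _ ⟩
    dot F (_·_ F M u) v                          ∎

  sum-·≈0 : ∀ {n} {M : Fin n → Fin n → Carrier} → (∀ s → sum (λ r → M r s) ≈ 0#) →
    ∀ w → sum (_·_ F M w) ≈ 0#
  sum-·≈0 {n} {M} column-sums≈0 w = begin
    sum (_·_ F M w)
      ≈⟨ sum-cong-≋ (λ r → reflexive (sumF≡sum n (λ s → M r s * w s))) ⟩
    sum (λ r → sum (λ s → M r s * w s))   ≈⟨ ∑-comm (λ r s → M r s * w s) ⟩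
    sum (λ s → sum (λ r → M r s * w s))
      ≈⟨ sum-cong-≋ (λ s → *-distribʳ-sum (w s) (λ r → M r s)) ⟨
    sum (λ s → sum (λ r → M r s) * w s)
      ≈⟨ sum-cong-≋ (λ s → *-congʳ (column-sums≈0 s)) ⟩
    sum (λ s → 0# * w s)                  ≈⟨ sum-cong-≋ (λ s → zeroˡ (w s)) ⟩
    sum {n} (λ _ → 0#)                    ≈⟨ sum-replicate-zero n ⟩
    0#                                    ∎

  if-×ᵐ-1# : ∀ b → (if b then 1 else 0) ×ᵐ 1# ≈ (if b then 1# else 0#)
  if-×ᵐ-1# true  = +-identityʳ 1#
  if-×ᵐ-1# false = refl

  module _ {n} (G : Graph n) where

    adjMatrix-symmetric : SymmetricMatrix (adjMatrix F G)
    adjMatrix-symmetric r s = reflexive (≡.cong (λ b → if b then 1# else 0#) (symmetric G r s))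

    adjMatrix-diagonal : ∀ r → adjMatrix F G r r ≈ 0#
    adjMatrix-diagonal r = reflexive (≡.cong (λ b → if b then 1# else 0#) (loopless G r))

    sum-adjMatrix-row : ∀ s → sum (adjMatrix F G s) ≈ degree G s ×ᵐ 1#
    sum-adjMatrix-row s = begin
      sum (adjMatrix F G s)                 ≈⟨ sum-cong-≋ (λ r → if-×ᵐ-1# (adj G s r)) ⟨
      sum (λ r → indicator r ×ᵐ 1#)         ≈⟨ ×ᵐ-sum-tabulate +-monoid indicator 1# ⟨
      ℕ.sum (tabulate indicator) ×ᵐ 1#
        ≡⟨ ≡.cong (λ ds → ℕ.sum ds ×ᵐ 1#) (map-tabulate id indicator) ⟨
      degree G s ×ᵐ 1#                      ∎
      where
      indicator : Fin n → ℕ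
      indicator r = if adj G s r then 1 else 0

  module _ (char2 : HasChar2 F) where

    x+x≈0 : ∀ x → x + x ≈ 0#
    x+x≈0 x = begin
      x + x              ≈⟨ +-cong (*-identityˡ x) (*-identityˡ x) ⟨
      1# * x + 1# * x    ≈⟨ distribʳ x 1# 1# ⟨
      (1# + 1#) * x      ≈⟨ *-congʳ char2 ⟩
      0# * x             ≈⟨ zeroˡ x ⟩
      0#                 ∎

    ×ᵐ-even≈0 : ∀ {m} → 2 ∣ m → ∀ x → m ×ᵐ x ≈ 0#
    ×ᵐ-even≈0 (divides q ≡.refl) x = begin
      (q ℕ.* 2) ×ᵐ x       ≡⟨ ≡.cong (_×ᵐ x) (ℕ.*-comm q 2) ⟩
      (2 ℕ.* q) ×ᵐ x       ≈⟨ ×-assocˡ x 2 q ⟨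
      y + (y + 0#)         ≈⟨ +-congˡ (+-identityʳ y) ⟩
      y + y                ≈⟨ x+x≈0 y ⟩
      0#                   ∎
      where y = q ×ᵐ x

    adjMatrix-column-sums≈0 : ∀ {n} (G : Graph n) → (∀ s → 2 ∣ degree G s) →
      ∀ s → sum (λ r → adjMatrix F G r s) ≈ 0#
    adjMatrix-column-sums≈0 G even-degrees s = begin
      sum (λ r → adjMatrix F G r s)   ≈⟨ sum-cong-≋ (λ r → adjMatrix-symmetric G r s) ⟩
      sum (adjMatrix F G s)           ≈⟨ sum-adjMatrix-row G s ⟩
      degree G s ×ᵐ 1#                ≈⟨ ×ᵐ-even≈0 (even-degrees s) 1# ⟩
      0#                              ∎

    ∑∑-symmetric≈∑-diagonal : ∀ {n} (f : Fin n → Fin n → Carrier) →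
      (∀ r s → f r s ≈ f s r) → sum (λ r → sum (λ s → f r s)) ≈ sum (λ r → f r r)
    ∑∑-symmetric≈∑-diagonal {ℕ.zero}  f f-sym = refl
    ∑∑-symmetric≈∑-diagonal {suc n} f f-sym = begin
      (f₀₀ + row) + sum (λ r → f (Fin.suc r) Fin.zero + sum (f′ r))
        ≈⟨ +-congˡ (∑-distrib-+ (λ r → f (Fin.suc r) Fin.zero) _) ⟩
      (f₀₀ + row) + (sum (λ r → f (Fin.suc r) Fin.zero) + sum (λ r → sum (f′ r)))
        ≈⟨ +-congˡ (+-cong (sum-cong-≋ (λ r → f-sym (Fin.suc r) Fin.zero))
                           (∑∑-symmetric≈∑-diagonal f′ (λ r s → f-sym (Fin.suc r) (Fin.suc s)))) ⟩
      (f₀₀ + row) + (row + diagonal)  ≈⟨ +-assoc f₀₀ row _ ⟩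
      f₀₀ + (row + (row + diagonal))  ≈⟨ +-congˡ (+-assoc row row diagonal) ⟨
      f₀₀ + ((row + row) + diagonal)  ≈⟨ +-congˡ (+-congʳ (x+x≈0 row)) ⟩
      f₀₀ + (0# + diagonal)           ≈⟨ +-congˡ (+-identityˡ diagonal) ⟩
      f₀₀ + diagonal                  ∎
      where
      f′ : Fin n → Fin n → Carrier
      f′ r s = f (Fin.suc r) (Fin.suc s)
      f₀₀ = f Fin.zero Fin.zero
      row = sum (λ s → f Fin.zero (Fin.suc s))
      diagonal = sum (λ r → f′ r r)

    dot-self≈sum² : ∀ {n} (x : Vector F n) → dot F x x ≈ sum x * sum x
    dot-self≈sum² {n} x = begin
      dot F x x                           ≡⟨ sumF≡sum n _ ⟩
      sum (λ r → x r * x r)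
        ≈⟨ ∑∑-symmetric≈∑-diagonal _ (λ r s → *-comm (x r) (x s)) ⟨
      sum (λ r → sum (λ s → x r * x s))   ≈⟨ sum-cong-≋ (λ r → *-distribˡ-sum (x r) x) ⟨
      sum (λ r → x r * sum x)             ≈⟨ *-distribʳ-sum (sum x) x ⟨
      sum x * sum x                       ∎

    dot-·-self≈0 : ∀ {n} {M : Fin n → Fin n → Carrier} → SymmetricMatrix M →
      (∀ r → M r r ≈ 0#) → ∀ x → dot F x (_·_ F M x) ≈ 0#
    dot-·-self≈0 {n} {M} M-sym M-diagonal x = begin
      dot F x (_·_ F M x)                          ≈⟨ dot-·-expand M x x ⟩
      sum (λ r → sum (λ s → x r * (M r s * x s)))
        ≈⟨ ∑∑-symmetric≈∑-diagonal _ (λ r s → *-sandwich-swap (x r) (x s) (M-sym r s)) ⟩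
      sum (λ r → x r * (M r r * x r))  ≈⟨ sum-cong-≋ (λ r → *-congˡ (*-congʳ (M-diagonal r))) ⟩
      sum (λ r → x r * (0# * x r))     ≈⟨ sum-cong-≋ (λ r → *-congˡ (zeroˡ (x r))) ⟩
      sum (λ r → x r * 0#)             ≈⟨ sum-cong-≋ (λ r → zeroʳ (x r)) ⟩
      sum {n} (λ _ → 0#)               ≈⟨ sum-replicate-zero n ⟩
      0#                               ∎

    dot-·-image≈0 : ∀ {n} {M : Fin n → Fin n → Carrier} →
      (∀ s → sum (λ r → M r s) ≈ 0#) → ∀ w → dot F (_·_ F M w) (_·_ F M w) ≈ 0#
    dot-·-image≈0 {M = M} column-sums≈0 w = begin
      dot F (_·_ F M w) (_·_ F M w)        ≈⟨ dot-self≈sum² (_·_ F M w) ⟩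
      sum (_·_ F M w) * sum (_·_ F M w)    ≈⟨ *-congʳ (sum-·≈0 column-sums≈0 w) ⟩
      0# * sum (_·_ F M w)                 ≈⟨ zeroˡ _ ⟩
      0#                                   ∎

    module NilpotentChain
      {n} {M : Fin n → Fin n → Carrier} (M-sym : SymmetricMatrix M)
      (M-diagonal : ∀ r → M r r ≈ 0#) (column-sums≈0 : ∀ s → sum (λ r → M r s) ≈ 0#)
      (L : ℕ) (v : ℕ → Vector F n)
      (v-descends : ∀ m → suc m < L → _≈ᵛ_ F (_·_ F M (v (suc m))) (v m))
      where

      v≈M·v-suc : ∀ {j} → suc j < L → _≈ᵛ_ F (v j) (_·_ F M (v (suc j)))
      v≈M·v-suc {j} j+1<L = sym ∘ v-descends j j+1<L

      dot-shift : ∀ {j k} → suc j < L → suc k < L →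
        dot F (v j) (v (suc k)) ≈ dot F (v (suc j)) (v k)
      dot-shift {j} {k} j+1<L k+1<L = begin
        dot F (v j) (v (suc k))                  ≈⟨ dot-cong (v≈M·v-suc j+1<L) (λ _ → refl) ⟩
        dot F (_·_ F M (v (suc j))) (v (suc k))  ≈⟨ ·-selfAdjoint M-sym _ _ ⟨
        dot F (v (suc j)) (_·_ F M (v (suc k)))  ≈⟨ dot-cong (λ _ → refl) (v-descends k k+1<L) ⟩
        dot F (v (suc j)) (v k)                  ∎

      dot-at-distance≈0 : ∀ d j → suc j < L → d ℕ.+ j < L → dot F (v j) (v (d ℕ.+ j)) ≈ 0#
      dot-at-distance≈0 0 j j+1<L _ = begin
        dot F (v j) (v j)                   ≈⟨ dot-cong (v≈M·v-suc j+1<L) (v≈M·v-suc j+1<L) ⟩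
        dot F (_·_ F M w) (_·_ F M w)       ≈⟨ dot-·-image≈0 column-sums≈0 w ⟩
        0#                                  ∎
        where w = v (suc j)
      dot-at-distance≈0 1 j j+1<L _ = begin
        dot F (v j) w                       ≈⟨ dot-cong (v≈M·v-suc j+1<L) (λ _ → refl) ⟩
        dot F (_·_ F M w) w                 ≈⟨ dot-comm _ w ⟩
        dot F w (_·_ F M w)                 ≈⟨ dot-·-self≈0 M-sym M-diagonal w ⟩
        0#                                  ∎
        where w = v (suc j)
      dot-at-distance≈0 (suc (suc d)) j j+1<L d+j+2<L = begin
        dot F (v j) (v (suc (suc (d ℕ.+ j))))  ≈⟨ dot-shift j+1<L d+j+2<L ⟩
        dot F (v (suc j)) (v (suc (d ℕ.+ j)))  ≡⟨ ≡.cong (dot F (v (suc j)) ∘ v) (+-suc d j) ⟨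
        dot F (v (suc j)) (v (d ℕ.+ suc j))    ≈⟨ dot-at-distance≈0 d (suc j) j+2<L d+j+1<L ⟩
        0#                                     ∎
        where
        j+2<L : suc (suc j) < L
        j+2<L = ≤-trans (s≤s (s≤s (s≤s (m≤n+m j d)))) d+j+2<L
        d+j+1<L : d ℕ.+ suc j < L
        d+j+1<L = ≡.subst (_< L) (≡.sym (+-suc d j)) (<⇒≤ d+j+2<L)

      dot≈0-ordered : ∀ {j k} → j ≤ k → k < L → ¬ (suc j ≡ L × suc k ≡ L) →
        dot F (v j) (v k) ≈ 0#
      dot≈0-ordered {j} {k} j≤k k<L not-corner = begin
        dot F (v j) (v k)              ≡⟨ ≡.cong (dot F (v j) ∘ v) (m∸n+n≡m j≤k) ⟨
        dot F (v j) (v (k ∸ j ℕ.+ j))  ≈⟨ dot-at-distance≈0 (k ∸ j) j j+1<L k∸j+j<L ⟩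
        0#                             ∎
        where
        j+1<L = below-corner⇒suc< j≤k k<L not-corner
        k∸j+j<L = ≡.subst (_< L) (≡.sym (m∸n+n≡m j≤k)) k<L

      dot≈0-off-corner : ∀ {j k} → j < L → k < L → ¬ (suc j ≡ L × suc k ≡ L) →
        dot F (v j) (v k) ≈ 0#
      dot≈0-off-corner {j} {k} j<L k<L not-corner with ≤-total j k
      ... | inj₁ j≤k = dot≈0-ordered j≤k k<L not-corner
      ... | inj₂ k≤j = trans (dot-comm (v j) (v k)) (dot≈0-ordered k≤j j<L (not-corner ∘ swap))

  -- The chain of block i re-indexed by ℕ, so that index arithmetic needs no
  -- casts between Fin types; entries beyond the block are junk.
  module JordanBlock
    {n} {A} (D : JordanDecomposition F n A) (i : Fin (JordanDecomposition.t D)) where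
    open JordanDecomposition D

    chain : ℕ → Vector F n
    chain m with m <? size i
    ... | yes m<ℓ = col i (fromℕ< m<ℓ)
    ... | no _    = λ _ → 0#

    chain-fromℕ< : ∀ {m} (m<ℓ : m < size i) → chain m ≡ col i (fromℕ< m<ℓ)
    chain-fromℕ< {m} m<ℓ with m <? size i
    ... | yes _   = ≡.refl
    ... | no m≮ℓ = contradiction m<ℓ m≮ℓ

    chain-toℕ : ∀ k → chain (toℕ k) ≡ col i k
    chain-toℕ k = ≡.trans (chain-fromℕ< (toℕ<n k)) (≡.cong (col i) (fromℕ<-toℕ k _))

    chain-descends : eigen i ≈ 0# → ∀ m → suc m < size i →
      _≈ᵛ_ F (_·_ F A (chain (suc m))) (chain m)
    chain-descends eigen≈0 m m+1<ℓ r = begin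
      _·_ F A (chain (suc m)) r       ≡⟨ ≡.cong (λ v → _·_ F A v r) (chain-fromℕ< m+1<ℓ) ⟩
      _·_ F A (col i k′) r            ≈⟨ chain-step i k k′ toℕ-k′≡1+toℕ-k r ⟩
      eigen i * col i k′ r + col i k r ≈⟨ +-congʳ (trans (*-congʳ eigen≈0) (zeroˡ _)) ⟩
      0# + col i k r                  ≈⟨ +-identityˡ _ ⟩
      col i k r                       ≡⟨ ≡.cong (λ v → v r) (chain-fromℕ< m<ℓ) ⟨
      chain m r                       ∎
      where
      m<ℓ = <⇒≤ m+1<ℓ
      k = fromℕ< m<ℓ
      k′ = fromℕ< m+1<ℓ
      toℕ-k′≡1+toℕ-k = ≡.trans (toℕ-fromℕ< m+1<ℓ) (≡.cong suc (≡.sym (toℕ-fromℕ< m<ℓ)))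

lemma10 : ∀ {c ℓ} (F : Field c ℓ) → HasChar2 F →
    ∀ (n : ℕ) (G : Graph n) → Eulerian G → 2 ∣ n →
    (D : JordanDecomposition F n (adjMatrix F G)) →
    (∀ i k → toℕ i ≡ 0 → toℕ k ≡ 0 →
      _≈ᵛ_ F (JordanDecomposition.col D i k) (ones F)) →
    ∀ i → Field._≈_ F (JordanDecomposition.eigen D i) (Field.0# F) →
    ∀ (j k : Fin (JordanDecomposition.size D i)) →
    ¬ (suc (toℕ j) ≡ JordanDecomposition.size D i
        × suc (toℕ k) ≡ JordanDecomposition.size D i) →
    Field._≈_ F (dot F (JordanDecomposition.col D i j) (JordanDecomposition.col D i k)) (Field.0# F)
lemma10 F char2 n G (_ , even-degrees) _ D _ i eigen≈0 j k not-corner = begin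
  dot F (col i j) (col i k)               ≡⟨ ≡.cong₂ (dot F) (chain-toℕ j) (chain-toℕ k) ⟨
  dot F (chain (toℕ j)) (chain (toℕ k))   ≈⟨ Chain.dot≈0-off-corner (toℕ<n j) (toℕ<n k) not-corner ⟩
  0#                                      ∎
  where
  open Field F
  open JordanDecomposition D
  open JordanBlock F D i
  open SetoidReasoning setoid
  module Chain = NilpotentChain F char2
    (adjMatrix-symmetric F G) (adjMatrix-diagonal F G)
    (adjMatrix-column-sums≈0 F char2 G even-degrees)
    (size i) chain (chain-descends eigen≈0)
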